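{- Let $z \geq 2$ be an integer which is not a multiple of $3$, and let $d(z) = z^2 + 3$. Then $$\log \varepsilon_{d(z)} \gg \big(\log \mathrm{sf}(d(z))\big)^2,$$ with an absolute implied constant.
   Context: For a non-square integer $d \geq 2$, $\varepsilon_d = t_1 + u_1\sqrt d$ denotes the fundamental solution of $t^2 - du^2 = 1$, i.e. the solution with $t_1,u_1 \geq 1$ such that all integer solutions are $\pm\varepsilon_d^n$, $n\in\mathbb{Z}$. For a positive integer $d$, written uniquely as $d = d_1 d_2^2$ with $d_1$ square-free, $\mathrm{sf}(d) := d_1$ is the square-free part of $d$. -}

module Defs where

open import Data.Nat using (ℕ; _+_; _*_; _≤_; _^_)
open import Data.Nat.Divisibility using (_∣_)
open import Data.Product using (Σ; _×_; ∃)
open import Relation.Binary.PropositionalEquality using (_≡_)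

IsPellSol : ℕ → ℕ → ℕ → Set
IsPellSol d t u = 1 ≤ t × 1 ≤ u × t * t ≡ d * (u * u) + 1

-- (t , u) gives the fundamental solution ε_d = t + u√d : the positive solution
-- with minimal t (equivalently minimal ε_d).
IsFundamentalSol : ℕ → ℕ → ℕ → Set
IsFundamentalSol d t u =
  IsPellSol d t u × (∀ t' u' → IsPellSol d t' u' → t ≤ t')

SquareFree : ℕ → Set
SquareFree n = ∀ p → p * p ∣ n → p ≡ 1

IsSquareFreePart : ℕ → ℕ → Set
IsSquareFreePart d s = SquareFree s × ∃ λ e → d ≡ s * (e * e)

{-# OPTIONS --safe #-}
-- Let d = z² + 3 and α = (z + √d)² = (2z² + 3) + 2z√d, of norm 9. As 3 ∤ z, no power of α
-- lies in the prime 𝔭 = (3, √d − z). Dividing αᵃ by a power of ε_d = t + u√d moves it into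
-- a fundamental domain, giving for a = 0, …, M elements xₐ + yₐ√d of norm 9ᵃ with
-- 3ᵃ ≤ xₐ ≤ 3ᵃ t. Their slopes yₐ / xₐ are pairwise distinct (equal slopes would make one a
-- 3-power multiple of another, hence in 𝔭), and distinct slopes force the ratios xₐ / 3ᵃ
-- apart by a factor z / 9ᴹ. So M + 1 such ratios in [1, t] give (z / 9ᴹ)ᴹ ≤ t, and
-- choosing 18ᴹ ≤ z < 18ᴹ⁺¹ yields log t ≥ M² ≫ (log d)² ≥ (log sf(d))².
module Submission where

open import Defs
open import Data.Nat using (ℕ; _+_; _*_; _≤_)
open import Data.Nat.Divisibility using (_∣_)
open import Data.Nat.Logarithm using (⌊log₂_⌋)
open import Data.Product using (∃)
open import Relation.Nullary using (¬_)

open import Data.Nat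
open import Data.Nat.Properties
open import Data.Nat.Divisibility
  using (_∣?_; ∣-refl; m∣m*n; ∣m⇒∣m*n; ∣m∣n⇒∣m+n; ∣m+n∣m⇒∣n; ∣1⇒≡1)
open import Data.Nat.Induction using (<-rec)
open import Data.Nat.Logarithm using (⌊log₂⌋-mono-≤; ⌊log₂[2^n]⌋≡n)
open import Data.Nat.Primality using (Prime; prime?; euclidsLemma)
open import Data.Nat.Tactic.RingSolver using (solve; solve-∀)
open import Algebra.Properties.CommutativeSemigroup *-commutativeSemigroup using (x∙yz≈y∙xz)
open import Data.Fin as Fin using (Fin; toℕ; fromℕ<)
open import Data.Fin.Properties using (pigeonhole; fromℕ<-injective; toℕ≤pred[n])
open import Data.List using ([]; _∷_)
open import Data.Product using (_×_; _,_; proj₁; proj₂; ∃-syntax)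
open import Data.Sum using (_⊎_; inj₁; inj₂; [_,_]′)
open import Data.Empty using (⊥; ⊥-elim)
open import Function using (_$_)
open import Relation.Nullary using (yes; no; contradiction)
open import Relation.Nullary.Decidable using (from-yes; from-no)
open import Relation.Unary using (Decidable)
open import Relation.Binary using (tri<; tri≈; tri>)
open import Relation.Binary.PropositionalEquality

m*m≤n*n⇒m≤n : ∀ {m n} → m * m ≤ n * n → m ≤ n
m*m≤n*n⇒m≤n m*m≤n*n = ≮⇒≥ λ n<m → <⇒≱ (*-mono-< n<m n<m) m*m≤n*n

m*m<n*n⇒m<n : ∀ {m n} → m * m < n * n → m < n
m*m<n*n⇒m<n m*m<n*n = ≰⇒> λ n≤m → <⇒≱ m*m<n*n (*-mono-≤ n≤m n≤m)

m*m≡n*n⇒m≡n : ∀ {m n} → m * m ≡ n * n → m ≡ n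
m*m≡n*n⇒m≡n eq = ≤-antisym (m*m≤n*n⇒m≤n (≤-reflexive eq)) (m*m≤n*n⇒m≤n (≤-reflexive (sym eq)))

^-distribʳ-* : ∀ m n k → (m * n) ^ k ≡ m ^ k * n ^ k
^-distribʳ-* m n zero    = refl
^-distribʳ-* m n (suc k) = begin
  m * n * (m * n) ^ k      ≡⟨ cong (m * n *_) (^-distribʳ-* m n k) ⟩
  m * n * (m ^ k * n ^ k)  ≡⟨ [m*n]*[o*p]≡[m*o]*[n*p] m n (m ^ k) (n ^ k) ⟩
  m ^ suc k * n ^ suc k    ∎
  where open ≡-Reasoning

n<2^n : ∀ n → n < 2 ^ n
n<2^n zero    = z<s
n<2^n (suc n) = begin-strict
  suc n           ≡⟨ +-comm 1 n ⟩
  n + 1           <⟨ +-mono-<-≤ (n<2^n n) (m^n>0 2 n) ⟩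
  2 ^ n + 2 ^ n   ≡⟨ cong (2 ^ n +_) (sym (+-identityʳ (2 ^ n))) ⟩
  2 ^ suc n       ∎
  where open ≤-Reasoning

crossing : ∀ {p} {P : ℕ → Set p} → Decidable P → ∀ n → P 0 → ¬ P n →
           ∃[ i ] i < n × P i × ¬ P (suc i)
crossing P? zero    P0 ¬Pn = contradiction P0 ¬Pn
crossing P? (suc n) P0 ¬P1+n with P? n
... | yes Pn = n , ≤-refl , Pn , ¬P1+n
... | no ¬Pn = let i , i<n , Pi , ¬P1+i = crossing P? n P0 ¬Pn
               in i , m<n⇒m<1+n i<n , Pi , ¬P1+i

2^m≤n⇒m≤⌊log₂n⌋ : ∀ {m n} → 2 ^ m ≤ n → m ≤ ⌊log₂ n ⌋
2^m≤n⇒m≤⌊log₂n⌋ {m} {n} 2^m≤n = subst (_≤ ⌊log₂ n ⌋) (⌊log₂[2^n]⌋≡n m) (⌊log₂⌋-mono-≤ 2^m≤n)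

n≤2^m⇒⌊log₂n⌋≤m : ∀ {m n} → n ≤ 2 ^ m → ⌊log₂ n ⌋ ≤ m
n≤2^m⇒⌊log₂n⌋≤m {m} {n} n≤2^m = subst (⌊log₂ n ⌋ ≤_) (⌊log₂[2^n]⌋≡n m) (⌊log₂⌋-mono-≤ n≤2^m)

square-free-part-≤ : ∀ {d s} → 0 < d → IsSquareFreePart d s → s ≤ d
square-free-part-≤ {s = s} d>0 (_ , zero , d≡s*0) =
  contradiction (trans d≡s*0 (*-zeroʳ s)) (>⇒≢ d>0)
square-free-part-≤ {s = s} d>0 (_ , suc e , d≡s*e²) =
  subst (s ≤_) (sym d≡s*e²) (m≤m*n s (suc e * suc e))

-- x + y√D has norm x² − D y² = n.
record HasNorm (D n x y : ℕ) : Set where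
  constructor norm
  field equation : x * x ≡ D * (y * y) + n

module NormForm (D : ℕ) where

  Dy²≤x² : ∀ {n x y} → HasNorm D n x y → D * (y * y) ≤ x * x
  Dy²≤x² {n} {y = y} (norm hx) = subst (D * (y * y) ≤_) (sym hx) (m≤m+n _ n)

  norm-root-≤ : ∀ {e x y} → HasNorm D (e * e) x y → e ≤ x
  norm-root-≤ {e} (norm hx) = m*m≤n*n⇒m≤n (subst (e * e ≤_) (sym hx) (m≤n+m _ _))

  -- N(αε) = N(ε) N(α) for α = x + y√D and ε = t + u√D, with N(α) left unevaluated so that it
  -- also recovers N(α) from N(αε). The two sides differ by (x² − Dy²)(t² − Du² − k).
  brahmagupta : ∀ {k} x y t u → HasNorm D k t u →
    (x * t + D * (y * u)) * (x * t + D * (y * u)) + k * (D * (y * y))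
      ≡ D * ((x * u + y * t) * (x * u + y * t)) + k * (x * x)
  brahmagupta {k} x y t u (norm ht) =
    +-cancelʳ-≡ (x * x * (D * (u * u) + k) + D * (y * y) * (t * t)) _ _ (begin
      (x * t + D * (y * u)) * (x * t + D * (y * u)) + k * (D * (y * y))
        + (x * x * (D * (u * u) + k) + D * (y * y) * (t * t))
          ≡⟨ solve (x ∷ y ∷ t ∷ u ∷ D ∷ k ∷ []) ⟩
      D * ((x * u + y * t) * (x * u + y * t)) + k * (x * x)
        + (x * x * (t * t) + D * (y * y) * (D * (u * u) + k))
          ≡⟨ cong₂ (λ A B → D * ((x * u + y * t) * (x * u + y * t)) + k * (x * x)
                              + (x * x * A + D * (y * y) * B)) ht (sym ht) ⟩
      D * ((x * u + y * t) * (x * u + y * t)) + k * (x * x)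
        + (x * x * (D * (u * u) + k) + D * (y * y) * (t * t)) ∎)
    where open ≡-Reasoning

  norm-* : ∀ {k n x y t u} → HasNorm D k t u → HasNorm D n x y →
           HasNorm D (k * n) (x * t + D * (y * u)) (x * u + y * t)
  norm-* {k} {n} {x} {y} {t} {u} ht (norm hx) = norm $ +-cancelʳ-≡ (k * (D * (y * y))) _ _ (begin
    (x * t + D * (y * u)) * (x * t + D * (y * u)) + k * (D * (y * y))
      ≡⟨ brahmagupta x y t u ht ⟩
    D * ((x * u + y * t) * (x * u + y * t)) + k * (x * x)
      ≡⟨ cong (λ v → D * ((x * u + y * t) * (x * u + y * t)) + k * v) hx ⟩
    D * ((x * u + y * t) * (x * u + y * t)) + k * (D * (y * y) + n)
      ≡⟨ solve (x ∷ y ∷ t ∷ u ∷ D ∷ k ∷ n ∷ []) ⟩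
    D * ((x * u + y * t) * (x * u + y * t)) + k * n + k * (D * (y * y)) ∎)
    where open ≡-Reasoning

  norm-/unit : ∀ {n x y t u} → HasNorm D 1 t u →
               HasNorm D n (x * t + D * (y * u)) (x * u + y * t) → HasNorm D n x y
  norm-/unit {n} {x} {y} {t} {u} ht (norm hxy) =
    norm $ +-cancelˡ-≡ (D * ((x * u + y * t) * (x * u + y * t))) _ _ (begin
    D * ((x * u + y * t) * (x * u + y * t)) + x * x
      ≡⟨ cong (D * ((x * u + y * t) * (x * u + y * t)) +_) (sym (*-identityˡ (x * x))) ⟩
    D * ((x * u + y * t) * (x * u + y * t)) + 1 * (x * x)
      ≡⟨ brahmagupta x y t u ht ⟨
    (x * t + D * (y * u)) * (x * t + D * (y * u)) + 1 * (D * (y * y))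
      ≡⟨ cong (_+ 1 * (D * (y * y))) hxy ⟩
    D * ((x * u + y * t) * (x * u + y * t)) + n + 1 * (D * (y * y))
      ≡⟨ solve (x ∷ y ∷ t ∷ u ∷ D ∷ n ∷ []) ⟩
    D * ((x * u + y * t) * (x * u + y * t)) + (D * (y * y) + n) ∎)
    where open ≡-Reasoning

  slope-gap : ∀ {Ea Eb xa ya xb yb} → HasNorm D Ea xa ya → HasNorm D Eb xb yb →
              xa * yb < ya * xb → D * (1 + 2 * (xa * yb)) ≤ Eb * (xa * xa)
  slope-gap {Ea} {Eb} {xa} {ya} {xb} {yb} ha (norm hb) slope =
    +-cancelʳ-≤ (D * ((xa * yb) * (xa * yb))) _ _ (begin
      D * (1 + 2 * (xa * yb)) + D * ((xa * yb) * (xa * yb))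
        ≡⟨ solve (D ∷ xa ∷ yb ∷ []) ⟩
      D * ((1 + xa * yb) * (1 + xa * yb))  ≤⟨ *-monoʳ-≤ D (*-mono-≤ slope slope) ⟩
      D * ((ya * xb) * (ya * xb))          ≡⟨ solve (D ∷ ya ∷ xb ∷ []) ⟩
      D * (ya * ya) * (xb * xb)            ≤⟨ *-monoˡ-≤ (xb * xb) (Dy²≤x² ha) ⟩
      xa * xa * (xb * xb)                  ≡⟨ cong (xa * xa *_) hb ⟩
      xa * xa * (D * (yb * yb) + Eb)       ≡⟨ solve (D ∷ xa ∷ yb ∷ Eb ∷ []) ⟩
      Eb * (xa * xa) + D * ((xa * yb) * (xa * yb)) ∎)
    where open ≤-Reasoning

  separation : ∀ {c Ea Eb xa ya xb yb} → c * c ≤ D → 1 ≤ xa →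
               HasNorm D Ea xa ya → HasNorm D Eb xb yb →
               xa * yb < ya * xb → c * xb ≤ Eb * xa
  separation {c} {Ea} {Eb} {xa} {ya} {xb} {yb} c²≤D xa≥1 ha hb@(norm hb-eq) slope =
    m*m≤n*n⇒m≤n (begin
    c * xb * (c * xb)                       ≡⟨ solve (c ∷ xb ∷ []) ⟩
    c * c * (xb * xb)                       ≤⟨ *-monoˡ-≤ (xb * xb) c²≤D ⟩
    D * (xb * xb)                           ≡⟨ cong (D *_) hb-eq ⟩
    D * (D * (yb * yb) + Eb)                ≡⟨ solve (D ∷ yb ∷ Eb ∷ []) ⟩
    D * Eb + D * yb * (D * yb)              ≤⟨ +-monoʳ-≤ (D * Eb) (*-monoʳ-≤ (D * yb) Dyb≤Ebxa) ⟩
    D * Eb + D * yb * (Eb * xa)             ≤⟨ +-monoʳ-≤ (D * Eb) (m≤m+n _ _) ⟩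
    D * Eb + (D * yb * (Eb * xa) + D * yb * (Eb * xa))
                                            ≡⟨ solve (D ∷ yb ∷ Eb ∷ xa ∷ []) ⟩
    Eb * (D * (1 + 2 * (xa * yb)))          ≤⟨ *-monoʳ-≤ Eb gap ⟩
    Eb * (Eb * (xa * xa))                   ≡⟨ solve (Eb ∷ xa ∷ []) ⟩
    Eb * xa * (Eb * xa)                     ∎)
    where
    open ≤-Reasoning
    instance
      xa≢0 : NonZero xa
      xa≢0 = >-nonZero xa≥1
    gap : D * (1 + 2 * (xa * yb)) ≤ Eb * (xa * xa)
    gap = slope-gap ha hb slope
    Dyb≤Ebxa : D * yb ≤ Eb * xa
    Dyb≤Ebxa = *-cancelˡ-≤ xa (begin
      xa * (D * yb)                ≡⟨ solve (xa ∷ D ∷ yb ∷ []) ⟩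
      D * (xa * yb)                ≤⟨ *-monoʳ-≤ D (m≤n+m _ 1) ⟩
      D * (1 + xa * yb)            ≤⟨ *-monoʳ-≤ D (+-monoʳ-≤ 1 (m≤m+n _ _)) ⟩
      D * (1 + 2 * (xa * yb))      ≤⟨ gap ⟩
      Eb * (xa * xa)               ≡⟨ solve (Eb ∷ xa ∷ []) ⟩
      xa * (Eb * xa)               ∎)

  proportional-roots : ∀ {ea eb xa ya xb yb} →
                       HasNorm D (ea * ea) xa ya → HasNorm D (eb * eb) xb yb →
                       ya * xb ≡ xa * yb → ea * xb ≡ eb * xa
  proportional-roots {ea} {eb} {xa} {ya} {xb} {yb} (norm ha) (norm hb) same-slope =
    m*m≡n*n⇒m≡n (+-cancelʳ-≡ (D * ((xa * yb) * (xa * yb))) _ _ (begin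
      ea * xb * (ea * xb) + D * ((xa * yb) * (xa * yb))
        ≡⟨ cong (λ v → ea * xb * (ea * xb) + D * (v * v)) same-slope ⟨
      ea * xb * (ea * xb) + D * ((ya * xb) * (ya * xb))
        ≡⟨ solve (D ∷ ea ∷ ya ∷ xb ∷ []) ⟩
      (D * (ya * ya) + ea * ea) * (xb * xb)  ≡⟨ cong (_* (xb * xb)) ha ⟨
      xa * xa * (xb * xb)                    ≡⟨ cong (xa * xa *_) hb ⟩
      xa * xa * (D * (yb * yb) + eb * eb)    ≡⟨ solve (D ∷ eb ∷ xa ∷ yb ∷ []) ⟩
      eb * xa * (eb * xa) + D * ((xa * yb) * (xa * yb)) ∎))
    where open ≡-Reasoning

module Reduction (D t u : ℕ) (ε : HasNorm D 1 t u) (u≥1 : 1 ≤ u) where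
  open NormForm D
  open HasNorm ε renaming (equation to t²≡Du²+1)

  Dyu≤xt : ∀ {n x y} → HasNorm D n x y → D * (y * u) ≤ x * t
  Dyu≤xt {x = x} {y} hx = m*m≤n*n⇒m≤n (begin
    D * (y * u) * (D * (y * u))  ≡⟨ solve (D ∷ y ∷ u ∷ []) ⟩
    D * (y * y) * (D * (u * u))  ≤⟨ *-mono-≤ (Dy²≤x² hx) (Dy²≤x² ε) ⟩
    x * x * (t * t)              ≡⟨ solve (x ∷ t ∷ []) ⟩
    x * t * (x * t)              ∎)
    where open ≤-Reasoning

  yt<y+xu : ∀ {n x y} → 1 ≤ n → HasNorm D n x y → y * t < y + x * u
  yt<y+xu {n} {x} {y} n≥1 (norm hx) = m*m<n*n⇒m<n (begin-strict
    y * t * (y * t)                ≡⟨ solve (y ∷ t ∷ []) ⟩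
    y * y * (t * t)                ≡⟨ cong (y * y *_) t²≡Du²+1 ⟩
    y * y * (D * (u * u) + 1)      <⟨ m<m+n _ 0<rest ⟩
    y * y * (D * (u * u) + 1) + (2 * y * (x * u) + n * (u * u))
                                   ≡⟨ solve (x ∷ y ∷ u ∷ D ∷ n ∷ []) ⟩
    y * y + 2 * y * (x * u) + (D * (y * y) + n) * (u * u)
                                   ≡⟨ cong (λ v → y * y + 2 * y * (x * u) + v * (u * u)) hx ⟨
    y * y + 2 * y * (x * u) + x * x * (u * u)
                                   ≡⟨ solve (x ∷ y ∷ u ∷ []) ⟩
    (y + x * u) * (y + x * u)      ∎)
    where
    open ≤-Reasoning
    0<rest : 0 < 2 * y * (x * u) + n * (u * u)
    0<rest = ≤-trans (*-mono-≤ n≥1 (*-mono-≤ u≥1 u≥1)) (m≤n+m _ _)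

  -- x′ + y′√D = (x + y√D)(t − u√D), and (t − u√D)(t + u√D) = 1.
  conjugate-inverse : ∀ {x y x′ y′} → D * (y * u) + x′ ≡ x * t → x * u + y′ ≡ y * t →
                      x ≡ x′ * t + D * (y′ * u) × y ≡ x′ * u + y′ * t
  conjugate-inverse {x} {y} {x′} {y′} ex ey = sym x-eq , sym y-eq
    where
    open ≡-Reasoning
    x-eq : x′ * t + D * (y′ * u) ≡ x
    x-eq = +-cancelʳ-≡ (D * (y * u) * t + D * u * (x * u)) _ _ (begin
      x′ * t + D * (y′ * u) + (D * (y * u) * t + D * u * (x * u))
                                        ≡⟨ solve (x ∷ y ∷ x′ ∷ y′ ∷ t ∷ u ∷ D ∷ []) ⟩
      (D * (y * u) + x′) * t + D * u * (x * u + y′)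
                                        ≡⟨ cong₂ (λ A B → A * t + D * u * B) ex ey ⟩
      x * t * t + D * u * (y * t)       ≡⟨ solve (x ∷ y ∷ t ∷ u ∷ D ∷ []) ⟩
      x * (t * t) + D * u * (y * t)     ≡⟨ cong (λ T → x * T + D * u * (y * t)) t²≡Du²+1 ⟩
      x * (D * (u * u) + 1) + D * u * (y * t)
                                        ≡⟨ solve (x ∷ y ∷ t ∷ u ∷ D ∷ []) ⟩
      x + (D * (y * u) * t + D * u * (x * u)) ∎)
    y-eq : x′ * u + y′ * t ≡ y
    y-eq = +-cancelʳ-≡ (D * (y * u) * u + x * u * t) _ _ (begin
      x′ * u + y′ * t + (D * (y * u) * u + x * u * t)
                                        ≡⟨ solve (x ∷ y ∷ x′ ∷ y′ ∷ t ∷ u ∷ D ∷ []) ⟩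
      (D * (y * u) + x′) * u + (x * u + y′) * t
                                        ≡⟨ cong₂ (λ A B → A * u + B * t) ex ey ⟩
      x * t * u + y * t * t             ≡⟨ solve (x ∷ y ∷ t ∷ u ∷ []) ⟩
      y * (t * t) + x * t * u           ≡⟨ cong (λ T → y * T + x * t * u) t²≡Du²+1 ⟩
      y * (D * (u * u) + 1) + x * t * u ≡⟨ solve (x ∷ y ∷ t ∷ u ∷ D ∷ []) ⟩
      y + (D * (y * u) * u + x * u * t) ∎)

  descend : ∀ {n x y} → 1 ≤ n → HasNorm D n x y → x * u ≤ y * t →
            ∃[ x′ ] ∃[ y′ ] x ≡ x′ * t + D * (y′ * u) × y ≡ x′ * u + y′ * t × y′ < y
  descend {x = x} {y} n≥1 hx xu≤yt =
    let x′ , ex = m≤n⇒∃[o]m+o≡n (Dyu≤xt hx)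
        y′ , ey = m≤n⇒∃[o]m+o≡n xu≤yt
        x≡ , y≡ = conjugate-inverse ex ey
    in x′ , y′ , x≡ , y≡ ,
       +-cancelˡ-< (x * u) y′ y (subst₂ _<_ (sym ey) (+-comm y (x * u)) (yt<y+xu n≥1 hx))

  -- For α = x + y√D of norm n, the conditions y ≥ 0 and yt < xu mean √n ≤ α < √n ε:
  -- a fundamental domain for multiplication by ε.
  record Reduced (n : ℕ) (P : ℕ → ℕ → Set) : Set where
    field
      x y         : ℕ
      has-norm    : HasNorm D n x y
      fundamental : y * t < x * u
      property    : P x y

  reduce : ∀ {n} (P : ℕ → ℕ → Set) →
           (∀ {x y} → P (x * t + D * (y * u)) (x * u + y * t) → P x y) →
           1 ≤ n → ∀ {x y} → HasNorm D n x y → P x y → Reduced n P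
  reduce {n} P P-descends n≥1 {y = y} = <-rec Reducible step y
    where
    Reducible : ℕ → Set
    Reducible y = ∀ {x} → HasNorm D n x y → P x y → Reduced n P
    step : ∀ y → (∀ {y′} → y′ < y → Reducible y′) → Reducible y
    step y rec {x} hx px with y * t <? x * u
    ... | yes yt<xu = record { x = x ; y = y ; has-norm = hx ; fundamental = yt<xu ; property = px }
    ... | no yt≮xu with x′ , y′ , refl , refl , y′<y ← descend n≥1 hx (≮⇒≥ yt≮xu)
        = rec y′<y {x′} (norm-/unit ε hx) (P-descends px)

  fundamental-≤ : ∀ {e x y} → HasNorm D (e * e) x y → y * t < x * u → x ≤ e * t
  fundamental-≤ {e} {x} {y} (norm hx) yt<xu = m*m≤n*n⇒m≤n
    (+-cancelʳ-≤ (D * (y * y) * (t * t)) _ _ (begin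
      x * x + D * (y * y) * (t * t)      ≡⟨ solve (x ∷ y ∷ t ∷ D ∷ []) ⟩
      x * x + D * ((y * t) * (y * t))    ≤⟨ +-monoʳ-≤ (x * x) (*-monoʳ-≤ D (*-mono-≤ yt≤xu yt≤xu)) ⟩
      x * x + D * ((x * u) * (x * u))    ≡⟨ solve (x ∷ u ∷ D ∷ []) ⟩
      x * x * (D * (u * u) + 1)          ≡⟨ cong (x * x *_) t²≡Du²+1 ⟨
      x * x * (t * t)                    ≡⟨ cong (_* (t * t)) hx ⟩
      (D * (y * y) + e * e) * (t * t)    ≡⟨ solve (e ∷ y ∷ t ∷ D ∷ []) ⟩
      e * t * (e * t) + D * (y * y) * (t * t) ∎))
    where
    open ≤-Reasoning
    yt≤xu : y * t ≤ x * u
    yt≤xu = <⇒≤ yt<xu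

module RatioSpread (t κ μ M : ℕ) (p q : ℕ → ℕ) where

  -- With rₐ = p a / q a: Level a i says rₐ ≥ (κ / μ)ⁱ, and Gap a b says rₐ ≥ (κ / μ) r_b.
  Level : ℕ → ℕ → Set
  Level a i = κ ^ i * q a ≤ μ ^ i * p a

  Gap : ℕ → ℕ → Set
  Gap a b = κ * q a * p b ≤ μ * q b * p a

  gap-raises-level : ∀ {a b i} → 1 ≤ q b → Gap a b → Level b i → Level a (suc i)
  gap-raises-level {a} {b} {i} qb≥1 gap level =
    *-cancelʳ-≤ _ _ (q b) {{>-nonZero qb≥1}}
      (lift (κ ^ i) (μ ^ i) (q a) (q b) (p a) (p b) level gap)
    where
    open ≤-Reasoning
    lift : ∀ K U qa qb pa pb → K * qb ≤ U * pb → κ * qa * pb ≤ μ * qb * pa →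
           κ * K * qa * qb ≤ μ * U * pa * qb
    lift K U qa qb pa pb level gap = begin
      κ * K * qa * qb    ≡⟨ solve (κ ∷ K ∷ qa ∷ qb ∷ []) ⟩
      K * qb * (κ * qa)  ≤⟨ *-monoˡ-≤ (κ * qa) level ⟩
      U * pb * (κ * qa)  ≡⟨ solve (κ ∷ U ∷ qa ∷ pb ∷ []) ⟩
      U * (κ * qa * pb)  ≤⟨ *-monoʳ-≤ U gap ⟩
      U * (μ * qb * pa)  ≡⟨ solve (μ ∷ U ∷ qb ∷ pa ∷ []) ⟩
      μ * U * pa * qb    ∎

  -- If (κ / μ)ᴹ > t, each rₐ ∈ [1, t] has a highest level below M; by pigeonhole two of the
  -- M + 1 ratios share it, and the gap between them lifts one of them higher.
  ratio-spread : (∀ a → 1 ≤ q a) → (∀ {a} → a ≤ M → q a ≤ p a) →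
                 (∀ {a} → a ≤ M → p a ≤ q a * t) →
                 (∀ {a b} → a ≤ M → b ≤ M → a < b → Gap a b ⊎ Gap b a) → κ ^ M ≤ μ ^ M * t
  ratio-spread q≥1 q≤p p≤qt gaps = ≮⇒≥ too-many-levels
    where
    too-many-levels : μ ^ M * t < κ ^ M → ⊥
    too-many-levels μᴹt<κᴹ = let a , b , a<b , same = pigeonhole (n<1+n M) bucket
                             in collision a b a<b same
      where
      open ≤-Reasoning
      ¬top : ∀ {a} → a ≤ M → ¬ Level a M
      ¬top {a} a≤M = <⇒≱ (begin-strict
        μ ^ M * p a        ≤⟨ *-monoʳ-≤ (μ ^ M) (p≤qt a≤M) ⟩
        μ ^ M * (q a * t)  ≡⟨ x∙yz≈y∙xz (μ ^ M) (q a) t ⟩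
        q a * (μ ^ M * t)  <⟨ *-monoʳ-< (q a) {{>-nonZero (q≥1 a)}} μᴹt<κᴹ ⟩
        q a * κ ^ M        ≡⟨ *-comm (q a) (κ ^ M) ⟩
        κ ^ M * q a        ∎)
      level : (a : Fin (suc M)) → ∃[ i ] i < M × Level (toℕ a) i × ¬ Level (toℕ a) (suc i)
      level a = crossing (λ i → κ ^ i * q (toℕ a) ≤? μ ^ i * p (toℕ a)) M
                         (*-monoʳ-≤ 1 (q≤p (toℕ≤pred[n] a))) (¬top (toℕ≤pred[n] a))
      bucket : Fin (suc M) → Fin M
      bucket a = fromℕ< (proj₁ (proj₂ (level a)))
      collision : ∀ a b → a Fin.< b → bucket a ≡ bucket b → ⊥
      collision a b a<b same with level a | level b | fromℕ<-injective _ _ _ _ same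
      ... | i , _ , La , ¬La′ | .i , _ , Lb , ¬Lb′ | refl
        with gaps (toℕ≤pred[n] a) (toℕ≤pred[n] b) a<b
      ...   | inj₁ gap = ¬La′ (gap-raises-level {i = i} (q≥1 (toℕ b)) gap Lb)
      ...   | inj₂ gap = ¬Lb′ (gap-raises-level {i = i} (q≥1 (toℕ a)) gap La)

residue-* : ∀ z x y a b → x * a + (z * z + 3) * (y * b) + z * (x * b + y * a)
                           ≡ 3 * (y * b) + (x + z * y) * (a + z * b)
residue-* = solve-∀

prime[3] : Prime 3
prime[3] = from-yes (prime? 3)

module PowersOfα (z t u : ℕ) (ε : HasNorm (z * z + 3) 1 t u) (u≥1 : 1 ≤ u) (3∤z : ¬ 3 ∣ z) where
  open NormForm (z * z + 3)
  open Reduction (z * z + 3) t u ε u≥1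

  -- x + y√d ∉ 𝔭 = (3, √d − z), the prime of norm 3 modulo which √d ≡ z.
  Outside𝔭 : ℕ → ℕ → Set
  Outside𝔭 x y = ¬ 3 ∣ x + z * y

  outside-descends : ∀ {x y a b} → Outside𝔭 (x * a + (z * z + 3) * (y * b)) (x * b + y * a) →
                     Outside𝔭 x y
  outside-descends {x} {y} {a} {b} ∉𝔭 3∣xy = ∉𝔭 (subst (3 ∣_) (sym (residue-* z x y a b))
    (∣m∣n⇒∣m+n (m∣m*n (y * b)) (∣m⇒∣m*n (a + z * b) 3∣xy)))

  outside-* : ∀ {x y a b} → Outside𝔭 x y → Outside𝔭 a b →
              Outside𝔭 (x * a + (z * z + 3) * (y * b)) (x * b + y * a)
  outside-* {x} {y} {a} {b} xy∉𝔭 ab∉𝔭 3∣product =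
    [ xy∉𝔭 , ab∉𝔭 ]′ (euclidsLemma (x + z * y) (a + z * b) prime[3]
      (∣m+n∣m⇒∣n (subst (3 ∣_) (residue-* z x y a b) 3∣product) (m∣m*n (y * b))))

  -- α = (z + √d)²
  α-norm : HasNorm (z * z + 3) 9 (2 * (z * z) + 3) (2 * z)
  α-norm = norm (solve (z ∷ []))

  α∉𝔭 : Outside𝔭 (2 * (z * z) + 3) (2 * z)
  α∉𝔭 3∣α = [ from-no (3 ∣? 4) , (λ 3∣z² → [ 3∤z , 3∤z ]′ (euclidsLemma z z prime[3] 3∣z²)) ]′
    (euclidsLemma 4 (z * z) prime[3] (∣m+n∣m⇒∣n (subst (3 ∣_) residue 3∣α) (∣-refl {3})))
    where
    residue : 2 * (z * z) + 3 + z * (2 * z) ≡ 3 + 4 * (z * z)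
    residue = solve (z ∷ [])

  power : ∀ a → Reduced (3 ^ a * 3 ^ a) Outside𝔭
  power zero = record
    { x = 1 ; y = 0
    ; has-norm = norm (sym (cong (_+ 1) (*-zeroʳ (z * z + 3))))
    ; fundamental = ≤-trans u≥1 (m≤m+n u 0)
    ; property = λ 3∣1 → contradiction (∣1⇒≡1 (subst (3 ∣_) (cong suc (*-zeroʳ z)) 3∣1)) λ ()
    }
  power (suc a) = subst (λ n → Reduced n Outside𝔭) (nine (3 ^ a))
    (reduce Outside𝔭 outside-descends (*-mono-≤ {1} {9} (s≤s z≤n) (*-mono-≤ 3ᵃ>0 3ᵃ>0))
            (norm-* α-norm has-norm) (outside-* property α∉𝔭))
    where
    open Reduced (power a)
    3ᵃ>0 : 3 ^ a > 0
    3ᵃ>0 = m^n>0 3 a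
    nine : ∀ e → 9 * (e * e) ≡ 3 * e * (3 * e)
    nine = solve-∀

  same-slope⇒∈𝔭 : ∀ {a b xa ya xb yb} → a < b →
                  HasNorm (z * z + 3) (3 ^ a * 3 ^ a) xa ya →
                  HasNorm (z * z + 3) (3 ^ b * 3 ^ b) xb yb →
                  1 ≤ xa → ya * xb ≡ xa * yb → 3 ∣ xb + z * yb
  same-slope⇒∈𝔭 {a} {b} {xa} {ya} {xb} {yb} a<b ha hb xa≥1 same-slope
    with k , refl ← m≤n⇒∃[o]m+o≡n a<b =
    subst (3 ∣_) (sym factor) (∣m⇒∣m*n (xa + z * ya) (m∣m*n (3 ^ k)))
    where
    open ≡-Reasoning
    3ᵇ≡3ᵃ3ᵏ⁺¹ : 3 ^ b ≡ 3 ^ a * 3 ^ suc k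
    3ᵇ≡3ᵃ3ᵏ⁺¹ = trans (cong (3 ^_) (sym (+-suc a k))) (^-distribˡ-+-* 3 a (suc k))
    xb≡ : xb ≡ 3 ^ suc k * xa
    xb≡ = *-cancelˡ-≡ xb (3 ^ suc k * xa) (3 ^ a) {{m^n≢0 3 a}} (begin
      3 ^ a * xb                    ≡⟨ proportional-roots {3 ^ a} {3 ^ b} ha hb same-slope ⟩
      3 ^ b * xa                    ≡⟨ cong (_* xa) 3ᵇ≡3ᵃ3ᵏ⁺¹ ⟩
      3 ^ a * 3 ^ suc k * xa        ≡⟨ *-assoc (3 ^ a) (3 ^ suc k) xa ⟩
      3 ^ a * (3 ^ suc k * xa)      ∎)
    yb≡ : yb ≡ 3 ^ suc k * ya
    yb≡ = *-cancelˡ-≡ yb (3 ^ suc k * ya) xa {{>-nonZero xa≥1}}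
      (trans (sym same-slope) (trans (cong (ya *_) xb≡) (swap (3 ^ suc k))))
      where
      swap : ∀ m → ya * (m * xa) ≡ xa * (m * ya)
      swap m = solve (m ∷ xa ∷ ya ∷ [])
    factor : xb + z * yb ≡ 3 ^ suc k * (xa + z * ya)
    factor = trans (cong₂ (λ x y → x + z * y) xb≡ yb≡) (distrib (3 ^ suc k))
      where
      distrib : ∀ m → m * xa + z * (m * ya) ≡ m * (xa + z * ya)
      distrib m = solve (m ∷ xa ∷ ya ∷ z ∷ [])

  X Y : ℕ → ℕ
  X a = Reduced.x (power a)
  Y a = Reduced.y (power a)

  3ᵃ≤X : ∀ a → 3 ^ a ≤ X a
  3ᵃ≤X a = norm-root-≤ (Reduced.has-norm (power a))

  X≤3ᵃt : ∀ a → X a ≤ 3 ^ a * t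
  X≤3ᵃt a = fundamental-≤ {3 ^ a} has-norm fundamental
    where open Reduced (power a)

  slopes⇒Gap : ∀ {M a b} → a ≤ M → b ≤ M → X a * Y b < Y a * X b →
                    z * 3 ^ a * X b ≤ 9 ^ M * 3 ^ b * X a
  slopes⇒Gap {M} {a} {b} a≤M b≤M slope =
    weigh (3 ^ a) (3 ^ b) (9 ^ M) (X a) (X b) 3ᵃ3ᵇ≤9ᴹ
      (separation {z} (m≤m+n (z * z) 3) (≤-trans (m^n>0 3 a) (3ᵃ≤X a))
                  (Reduced.has-norm (power a)) (Reduced.has-norm (power b)) slope)
    where
    open ≤-Reasoning
    3ᵃ3ᵇ≤9ᴹ : 3 ^ a * 3 ^ b ≤ 9 ^ M
    3ᵃ3ᵇ≤9ᴹ = begin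
      3 ^ a * 3 ^ b  ≤⟨ *-mono-≤ (^-monoʳ-≤ 3 a≤M) (^-monoʳ-≤ 3 b≤M) ⟩
      3 ^ M * 3 ^ M  ≡⟨ ^-distribʳ-* 3 3 M ⟨
      9 ^ M          ∎
    weigh : ∀ ea eb μ xa xb → ea * eb ≤ μ → z * xb ≤ eb * eb * xa → z * ea * xb ≤ μ * eb * xa
    weigh ea eb μ xa xb eaeb≤μ sep = begin
      z * ea * xb          ≡⟨ solve (z ∷ ea ∷ xb ∷ []) ⟩
      ea * (z * xb)        ≤⟨ *-monoʳ-≤ ea sep ⟩
      ea * (eb * eb * xa)  ≡⟨ solve (ea ∷ eb ∷ xa ∷ []) ⟩
      ea * eb * (eb * xa)  ≤⟨ *-monoˡ-≤ (eb * xa) eaeb≤μ ⟩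
      μ * (eb * xa)        ≡⟨ solve (μ ∷ eb ∷ xa ∷ []) ⟩
      μ * eb * xa          ∎

  zᴹ≤[9ᴹ]ᴹ*t : ∀ M → z ^ M ≤ (9 ^ M) ^ M * t
  zᴹ≤[9ᴹ]ᴹ*t M = ratio-spread (m^n>0 3) (λ {a} _ → 3ᵃ≤X a) (λ {a} _ → X≤3ᵃt a) gaps
    where
    open RatioSpread t z (9 ^ M) M X (3 ^_)
    gaps : ∀ {a b} → a ≤ M → b ≤ M → a < b → Gap a b ⊎ Gap b a
    gaps {a} {b} a≤M b≤M a<b with <-cmp (X a * Y b) (Y a * X b)
    ... | tri< slope _ _ = inj₁ (slopes⇒Gap a≤M b≤M slope)
    ... | tri> _ _ slope =
      inj₂ (slopes⇒Gap b≤M a≤M (subst₂ _<_ (*-comm (Y a) (X b)) (*-comm (X a) (Y b)) slope))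
    ... | tri≈ _ same _ = ⊥-elim (Reduced.property (power b)
      (same-slope⇒∈𝔭 a<b (Reduced.has-norm (power a)) (Reduced.has-norm (power b))
                        (≤-trans (m^n>0 3 a) (3ᵃ≤X a)) (sym same)))

square-≤-484* : ∀ {L M T} → L ≤ 11 * suc M → M * M ≤ T → 1 ≤ T → L * L ≤ 484 * T
square-≤-484* {L} {zero} {T} L≤11 _ T≥1 = begin
  L * L     ≤⟨ *-mono-≤ L≤11 L≤11 ⟩
  121       ≤⟨ m≤m+n 121 363 ⟩
  484 * 1   ≤⟨ *-monoʳ-≤ 484 T≥1 ⟩
  484 * T   ∎
  where open ≤-Reasoning
square-≤-484* {L} {suc m} {T} L≤ M²≤T _ = begin
  L * L                             ≤⟨ *-mono-≤ L≤22[1+m] L≤22[1+m] ⟩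
  22 * suc m * (22 * suc m)         ≡⟨ solve (m ∷ []) ⟩
  484 * (suc m * suc m)             ≤⟨ *-monoʳ-≤ 484 M²≤T ⟩
  484 * T                           ∎
  where
  open ≤-Reasoning
  11[2+m]+11m : 11 * suc (suc m) + 11 * m ≡ 22 * suc m
  11[2+m]+11m = solve (m ∷ [])
  L≤22[1+m] : L ≤ 22 * suc m
  L≤22[1+m] = ≤-trans L≤ (≤-trans (m≤m+n _ (11 * m)) (≤-reflexive 11[2+m]+11m))

module _ {z : ℕ} (z≥2 : 2 ≤ z) where

  log₂-sf-≤ : ∀ {s M} → z < 18 ^ suc M → IsSquareFreePart (z * z + 3) s → ⌊log₂ s ⌋ ≤ 11 * suc M
  log₂-sf-≤ {s} {M} z<18ᴹ⁺¹ sf = n≤2^m⇒⌊log₂n⌋≤m (begin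
    s                        ≤⟨ square-free-part-≤ (≤-trans (s≤s z≤n) (m≤n+m 3 (z * z))) sf ⟩
    z * z + 3                ≤⟨ +-monoʳ-≤ (z * z) (≤-trans 3≤z² (m≤m+n (z * z) 0)) ⟩
    2 * (z * z)              ≤⟨ *-monoʳ-≤ 2 (*-mono-≤ z≤2ᵂ z≤2ᵂ) ⟩
    2 * (2 ^ W * 2 ^ W)      ≡⟨ cong (2 *_) (^-distribˡ-+-* 2 W W) ⟨
    2 ^ suc (W + W)          ≤⟨ ^-monoʳ-≤ 2 (≤-trans (m≤m+n _ M) (≤-reflexive exponent)) ⟩
    2 ^ (11 * suc M)         ∎)
    where
    open ≤-Reasoning
    W : ℕ
    W = 5 * suc M
    3≤z² : 3 ≤ z * z
    3≤z² = ≤-trans (n≤1+n 3) (*-mono-≤ z≥2 z≥2)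
    z≤2ᵂ : z ≤ 2 ^ W
    z≤2ᵂ = begin
      z              ≤⟨ <⇒≤ z<18ᴹ⁺¹ ⟩
      18 ^ suc M     ≤⟨ ^-monoˡ-≤ (suc M) (m≤m+n 18 14) ⟩
      32 ^ suc M     ≡⟨ ^-*-assoc 2 5 (suc M) ⟩
      2 ^ W          ∎
    exponent : suc (5 * suc M + 5 * suc M) + M ≡ 11 * suc M
    exponent = solve (M ∷ [])

  module _ {t u : ℕ} (3∤z : ¬ 3 ∣ z) (pell : IsPellSol (z * z + 3) t u) where
    u≥1 : 1 ≤ u
    u≥1 = proj₁ (proj₂ pell)
    ε : HasNorm (z * z + 3) 1 t u
    ε = norm (proj₂ (proj₂ pell))
    open PowersOfα z t u ε u≥1 3∤z using (zᴹ≤[9ᴹ]ᴹ*t)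

    square-≤-log₂-ε : ∀ {M} → 18 ^ M ≤ z → M * M ≤ ⌊log₂ t ⌋
    square-≤-log₂-ε {M} 18ᴹ≤z =
      2^m≤n⇒m≤⌊log₂n⌋ (*-cancelˡ-≤ ((9 ^ M) ^ M) {{m^n≢0 (9 ^ M) M {{m^n≢0 9 M}}}} (begin
      (9 ^ M) ^ M * 2 ^ (M * M)   ≡⟨ cong ((9 ^ M) ^ M *_) (^-*-assoc 2 M M) ⟨
      (9 ^ M) ^ M * (2 ^ M) ^ M   ≡⟨ ^-distribʳ-* (9 ^ M) (2 ^ M) M ⟨
      (9 ^ M * 2 ^ M) ^ M         ≡⟨ cong (_^ M) (^-distribʳ-* 9 2 M) ⟨
      (18 ^ M) ^ M                ≤⟨ ^-monoˡ-≤ M 18ᴹ≤z ⟩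
      z ^ M                       ≤⟨ zᴹ≤[9ᴹ]ᴹ*t M ⟩
      (9 ^ M) ^ M * t             ∎))
      where open ≤-Reasoning

    log₂-ε-≥1 : 1 ≤ ⌊log₂ t ⌋
    log₂-ε-≥1 = 2^m≤n⇒m≤⌊log₂n⌋ {1} (m*m≤n*n⇒m≤n {2} {t} (begin
      4                            ≤⟨ +-monoˡ-≤ 1 (*-mono-≤ (m≤n+m 3 (z * z)) (*-mono-≤ u≥1 u≥1)) ⟩
      (z * z + 3) * (u * u) + 1    ≡⟨ HasNorm.equation ε ⟨
      t * t                        ∎))
      where open ≤-Reasoning

corollary3p3 : ∃ λ (c : ℕ) → ∀ (z t u s : ℕ) → 2 ≤ z → ¬ (3 ∣ z)
    → IsFundamentalSol (z * z + 3) t u → IsSquareFreePart (z * z + 3) s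
    → ⌊log₂ s ⌋ * ⌊log₂ s ⌋ ≤ c * ⌊log₂ t ⌋
corollary3p3 = 484 , λ z t u s z≥2 3∤z (pell , _) sf →
  let z<18ᶻ = <-≤-trans (n<2^n z) (^-monoˡ-≤ z (m≤m+n 2 16))
      M , _ , 18ᴹ≤z , 18ᴹ⁺¹≰z = crossing (λ M → 18 ^ M ≤? z) z (≤-trans (s≤s z≤n) z≥2) (<⇒≱ z<18ᶻ)
  in square-≤-484* {M = M} (log₂-sf-≤ z≥2 {M = M} (≰⇒> 18ᴹ⁺¹≰z) sf)
                   (square-≤-log₂-ε z≥2 3∤z pell {M} 18ᴹ≤z)
                   (log₂-ε-≥1 z≥2 3∤z pell)
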